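{- Let $k+1$ and $p>k^2+k$ be odd primes and let $(u_1,\ldots,u_k)\in\mathbb{Z}_{>0}^k$. If $\gcd(u_1,\ldots,u_k)=1$ and $u_i\equiv i \pmod p$ for all $i=1,\ldots,k$, then there exists a real number $t$ such that $\lVert t u_i\rVert\ge \frac{1}{k+1}$ for all $i=1,\ldots,k$.
   Context: For a real number $x$, $\lVert x\rVert$ denotes the distance from $x$ to the nearest integer. -}

module Defs where

open import Data.Nat using (ℕ; zero; suc)
open import Data.Nat.GCD using (gcd)
open import Data.Fin using (Fin)
open import Data.Integer using (ℤ)
open import Data.Rational using (ℚ; _-_; _⊓_; floor; ceiling; _/_)

‖_‖ : ℚ → ℚ
‖ x ‖ = (x - (floor x / 1)) ⊓ ((ceiling x / 1) - x)

gcdFin : (k : ℕ) → (Fin k → ℕ) → ℕ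
gcdFin zero    u = 0
gcdFin (suc k) u = gcd (u Fin.zero) (gcdFin k (λ i → u (Fin.suc i)))

module Submission where

-- Let n = k + 1 and u i = i + w i * p.  It suffices to find m such that every m * u i is at distance at
-- least p from the multiples of n * p; then t = m / (n * p) works.  If n divides no u i, m = p does.
-- Otherwise n divides some u j but, as gcd u = 1, not some u i₀.  Put ℓ σ i = i * σ + w i.  The power
-- sums ∑_σ σ^e vanish modulo n for e < n - 1, so ∑_σ ∏_i ℓ σ i ≡ k! * k (mod n); on the other hand
-- ∏_i ℓ σ i is 0 when some ℓ σ i vanishes and k! when the ℓ σ i run through all nonzero residues.  As
-- ℓ j and ℓ i₀ have different roots, some σ makes all ℓ σ i avoid both 0 and some nonzero residue f,
-- and a suitable m ≡ -f⁻¹ (mod n) works.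

module NumberTheory where
  open import Data.Nat
  open import Data.Nat.Properties
  open import Data.Nat.DivMod
  open import Data.Nat.Divisibility
  open import Data.Nat.GCD using (gcd-greatest; module Bézout)
  open import Data.Nat.Coprimality using (coprime-Bézout; prime⇒coprime)
  open import Data.Nat.Primality using (Prime; euclidsLemma; prime⇒nonTrivial)
  open import Data.Nat.Induction using (<-rec)
  open import Data.Nat.Tactic.RingSolver using (solve-∀)
  open import Data.Fin as Fin using (Fin; zero; suc; toℕ; fromℕ<; punchIn; punchOut)
  open import Data.Fin.Properties
    using (toℕ-injective; toℕ<n; toℕ-fromℕ; toℕ-fromℕ<; toℕ-inject₁; punchIn-punchOut; punchOut-injective;
           injective⇒≤; any?; all?; ¬∀⟶∃¬)
  open import Data.Fin.Permutation using (Permutation; permutation)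
  open import Data.Vec.Functional using (removeAt)
  open import Algebra.Properties.Semiring.Sum +-*-semiring
    using (sum; sum-syntax; ∑-distrib-+; *-distribˡ-sum; sum-init-last; sum-cong-≗; sum-remove)
  open import Algebra.Properties.CommutativeMonoid.Sum *-1-commutativeMonoid
    using () renaming (sum to ∏; sum-cong-≗ to ∏-cong-≗; ∑-permute to ∏-permute; ∑-distrib-+ to ∏-distrib-*)
  open import Data.Product using (∃; ∃₂; _×_; _,_; proj₁; proj₂)
  open import Data.Sum using (inj₁; inj₂)
  open import Data.Empty using (⊥-elim)
  open import Function using (_∘_)
  open import Function.Definitions using (Injective)
  open import Relation.Binary.Bundles using (Setoid)
  open import Relation.Binary.Structures using (IsEquivalence)
  import Relation.Binary.Reasoning.Setoid
  open import Relation.Binary.PropositionalEquality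
  open import Relation.Nullary using (¬_; Dec; yes; no; ¬?; _×-dec_)
  open import Relation.Nullary.Decidable using (map′)
  open import Defs using (gcdFin)

  injective⇒surjective : ∀ {m} (g : Fin m → Fin m) → Injective _≡_ _≡_ g → ∀ y → ∃ λ x → g x ≡ y
  injective⇒surjective {zero} g g-inj ()
  injective⇒surjective {suc m} g g-inj y with any? (λ x → g x Fin.≟ y)
  ... | yes hit = hit
  ... | no miss = ⊥-elim (<-irrefl refl (injective⇒≤ {f = g′} g′-inj))
    where
    g′ : Fin (suc m) → Fin m
    g′ x = punchOut {i = y} {j = g x} (λ y≡gx → miss (x , sym y≡gx))
    g′-inj : Injective _≡_ _≡_ g′
    g′-inj eq = g-inj (punchOut-injective {i = y} _ _ eq)

  ∏-const : ∀ L a → ∏ {L} (λ _ → a) ≡ a ^ L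
  ∏-const zero    a = refl
  ∏-const (suc L) a = cong (a *_) (∏-const L a)

  ∏-∣ : ∀ {d L} (f : Fin L → ℕ) i → d ∣ f i → d ∣ ∏ f
  ∏-∣ f zero    d∣fi = ∣m⇒∣m*n (∏ (f ∘ suc)) d∣fi
  ∏-∣ f (suc i) d∣fi = ∣n⇒∣m*n (f zero) (∏-∣ (f ∘ suc) i d∣fi)

  ∑-1 : ∀ N → ∑[ σ < N ] 1 ≡ N
  ∑-1 zero    = refl
  ∑-1 (suc N) = cong suc (∑-1 N)

  ∑-snoc : ∀ N (f : ℕ → ℕ) → ∑[ σ < suc N ] f (toℕ σ) ≡ ∑[ σ < N ] f (toℕ σ) + f N
  ∑-snoc N f = trans (sum-init-last {N} (f ∘ toℕ))
    (cong₂ _+_ (sum-cong-≗ {N} (cong f ∘ toℕ-inject₁)) (cong f (toℕ-fromℕ N)))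

  ∑-≤ : ∀ {N} (f : Fin N → ℕ) → (∀ σ → f σ ≤ 1) → sum f ≤ N
  ∑-≤ {zero}  _ _   = z≤n
  ∑-≤ {suc N} f f≤1 = +-mono-≤ (f≤1 zero) (∑-≤ (f ∘ suc) (f≤1 ∘ suc))

  ∑-≤-zero : ∀ {N} (f : Fin N → ℕ) → (∀ σ → f σ ≤ 1) → ∀ {σ} → f σ ≡ 0 → 1 + sum f ≤ N
  ∑-≤-zero {suc N} f f≤1 {σ} fσ≡0 = begin
    1 + sum f                         ≡⟨ cong suc (sum-remove {i = σ} f) ⟩
    1 + (f σ + sum (removeAt f σ))    ≡⟨ cong (λ x → 1 + (x + sum (removeAt f σ))) fσ≡0 ⟩
    1 + sum (removeAt f σ)            ≤⟨ s≤s (∑-≤ (removeAt f σ) (f≤1 ∘ punchIn σ)) ⟩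
    suc N                             ∎
    where open ≤-Reasoning

  ∑-≤-two-zeros : ∀ {N} (f : Fin N → ℕ) → (∀ σ → f σ ≤ 1) →
                  ∀ {σ₁ σ₂} → σ₁ ≢ σ₂ → f σ₁ ≡ 0 → f σ₂ ≡ 0 → 2 + sum f ≤ N
  ∑-≤-two-zeros {suc N} f f≤1 {σ₁} {σ₂} σ₁≢σ₂ fσ₁≡0 fσ₂≡0 = begin
    2 + sum f                         ≡⟨ cong (2 +_) (sum-remove {i = σ₁} f) ⟩
    2 + (f σ₁ + sum (removeAt f σ₁))  ≡⟨ cong (λ x → 2 + (x + sum (removeAt f σ₁))) fσ₁≡0 ⟩
    1 + (1 + sum (removeAt f σ₁))     ≤⟨ s≤s (∑-≤-zero (removeAt f σ₁) (f≤1 ∘ punchIn σ₁) f[σ₂]≡0) ⟩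
    suc N                             ∎
    where
    open ≤-Reasoning
    f[σ₂]≡0 : removeAt f σ₁ (punchOut σ₁≢σ₂) ≡ 0
    f[σ₂]≡0 = trans (cong f (punchIn-punchOut σ₁≢σ₂)) fσ₂≡0

  infixl 8 _↑_
  _↑_ : ℕ → ℕ → ℕ
  x ↑ zero  = 1
  x ↑ suc e = x * (suc x ↑ e)

  ↑-snoc : ∀ x e → x ↑ suc e ≡ x ↑ e * (x + e)
  ↑-snoc x zero    = trans (*-identityʳ x) (sym (trans (*-identityˡ (x + 0)) (+-identityʳ x)))
  ↑-snoc x (suc e) = begin
    x * (suc x ↑ suc e)            ≡⟨ cong (x *_) (↑-snoc (suc x) e) ⟩
    x * (suc x ↑ e * (suc x + e))  ≡⟨ *-assoc x _ _ ⟨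
    x * (suc x ↑ e) * (suc x + e)  ≡⟨ cong (x * (suc x ↑ e) *_) (+-suc x e) ⟨
    x * (suc x ↑ e) * (x + suc e)  ∎
    where open ≡-Reasoning

  ↑-∏ : ∀ x e → x ↑ e ≡ ∏ {e} (λ i → x + toℕ i)
  ↑-∏ x zero    = refl
  ↑-∏ x (suc e) = cong₂ _*_ (sym (+-identityʳ x)) (trans (↑-∏ (suc x) e) (sym (∏-cong-≗ {e} (λ i → +-suc x (toℕ i)))))

  ∑-↑ : ∀ e N → suc (suc e) * ∑[ σ < suc N ] (toℕ σ ↑ suc e) ≡ N ↑ suc (suc e)
  ∑-↑ e zero    = *-zeroʳ (suc (suc e))
  ∑-↑ e (suc N) = begin
    E * ∑[ σ < suc (suc N) ] (toℕ σ ↑ suc e)       ≡⟨ cong (E *_) (∑-snoc (suc N) (_↑ suc e)) ⟩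
    E * (∑[ σ < suc N ] (toℕ σ ↑ suc e) + X)       ≡⟨ *-distribˡ-+ E (∑[ σ < suc N ] (toℕ σ ↑ suc e)) X ⟩
    E * ∑[ σ < suc N ] (toℕ σ ↑ suc e) + E * X     ≡⟨ cong (_+ E * X) (∑-↑ e N) ⟩
    N * X + E * X                                   ≡⟨ *-distribʳ-+ X N E ⟨
    (N + E) * X                                     ≡⟨ *-comm (N + E) X ⟩
    X * (N + E)                                     ≡⟨ cong (X *_) (+-suc N (suc e)) ⟩
    X * (suc N + suc e)                             ≡⟨ ↑-snoc (suc N) (suc e) ⟨
    suc N ↑ suc (suc e)                             ∎
    where
    open ≡-Reasoning
    E = suc (suc e)
    X = suc N ↑ suc e

  module Congruence (n : ℕ) .{{_ : NonZero n}} where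

    infix 4 _≋_
    record _≋_ (a b : ℕ) : Set where
      constructor %≡⇒≋
      field ≋⇒%≡ : a % n ≡ b % n
    open _≋_ public

    ≋-isEquivalence : IsEquivalence _≋_
    ≋-isEquivalence = record
      { refl  = %≡⇒≋ refl
      ; sym   = λ (%≡⇒≋ e) → %≡⇒≋ (sym e)
      ; trans = λ (%≡⇒≋ e) (%≡⇒≋ f) → %≡⇒≋ (trans e f)
      }

    ≋-setoid : Setoid _ _
    ≋-setoid = record { isEquivalence = ≋-isEquivalence }

    module ≋-Reasoning = Relation.Binary.Reasoning.Setoid ≋-setoid

    open IsEquivalence ≋-isEquivalence public
      renaming (refl to ≋-refl; sym to ≋-sym; trans to ≋-trans; reflexive to ≡⇒≋)

    +-cong : ∀ {a b c d} → a ≋ b → c ≋ d → a + c ≋ b + d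
    +-cong {a} {b} {c} {d} (%≡⇒≋ e) (%≡⇒≋ f) = %≡⇒≋ (begin
      (a + c) % n           ≡⟨ %-distribˡ-+ a c n ⟩
      (a % n + c % n) % n   ≡⟨ cong₂ (λ x y → (x + y) % n) e f ⟩
      (b % n + d % n) % n   ≡⟨ %-distribˡ-+ b d n ⟨
      (b + d) % n           ∎)
      where open ≡-Reasoning

    *-cong : ∀ {a b c d} → a ≋ b → c ≋ d → a * c ≋ b * d
    *-cong {a} {b} {c} {d} (%≡⇒≋ e) (%≡⇒≋ f) = %≡⇒≋ (begin
      (a * c) % n             ≡⟨ %-distribˡ-* a c n ⟩
      (a % n * (c % n)) % n   ≡⟨ cong₂ (λ x y → (x * y) % n) e f ⟩
      (b % n * (d % n)) % n   ≡⟨ %-distribˡ-* b d n ⟨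
      (b * d) % n             ∎)
      where open ≡-Reasoning

    +-congˡ : ∀ {a b} c → a ≋ b → c + a ≋ c + b
    +-congˡ c = +-cong (≋-refl {c})

    *-congˡ : ∀ {a b} c → a ≋ b → c * a ≋ c * b
    *-congˡ c = *-cong (≋-refl {c})

    _≋?_ : ∀ a b → Dec (a ≋ b)
    a ≋? b = map′ %≡⇒≋ ≋⇒%≡ (a % n ≟ b % n)

    ≋∧<⇒≡ : ∀ {a b} → a < n → b < n → a ≋ b → a ≡ b
    ≋∧<⇒≡ a<n b<n (%≡⇒≋ e) = trans (sym (m<n⇒m%n≡m a<n)) (trans e (m<n⇒m%n≡m b<n))

    ∑-cong : ∀ {L} {f g : Fin L → ℕ} → (∀ i → f i ≋ g i) → sum f ≋ sum g
    ∑-cong {zero}  _   = ≋-refl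
    ∑-cong {suc L} f≋g = +-cong (f≋g zero) (∑-cong (f≋g ∘ suc))

    ∏-cong : ∀ {L} {f g : Fin L → ℕ} → (∀ i → f i ≋ g i) → ∏ f ≋ ∏ g
    ∏-cong {zero}  _   = ≋-refl
    ∏-cong {suc L} f≋g = *-cong (f≋g zero) (∏-cong (f≋g ∘ suc))

    %-≋ : ∀ a → a % n ≋ a
    %-≋ a = %≡⇒≋ (m%n%n≡m%n a n)

    ∣⇒≋0 : ∀ {a} → n ∣ a → a ≋ 0
    ∣⇒≋0 {a} n∣a = %≡⇒≋ (trans (n∣m⇒m%n≡0 a n n∣a) (sym (m<n⇒m%n≡m (>-nonZero⁻¹ n))))

    ≋0⇒∣ : ∀ {a} → a ≋ 0 → n ∣ a
    ≋0⇒∣ {a} (%≡⇒≋ e) = m%n≡0⇒n∣m a n (trans e (m<n⇒m%n≡m (>-nonZero⁻¹ n)))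

    ∣-resp-≋ : ∀ {a b} → a ≋ b → n ∣ a → n ∣ b
    ∣-resp-≋ a≋b n∣a = ≋0⇒∣ (≋-trans (≋-sym a≋b) (∣⇒≋0 n∣a))

    +-cancelʳ-≋ : ∀ {a b} c → a + c ≋ b + c → a ≋ b
    +-cancelʳ-≋ {a} {b} c eq = begin
      a               ≈⟨ shift a ⟨
      a + c + c⁻      ≈⟨ +-cong eq ≋-refl ⟩
      b + c + c⁻      ≈⟨ shift b ⟩
      b               ∎
      where
      open ≋-Reasoning
      c⁻ = n ∸ c % n
      shift : ∀ x → x + c + c⁻ ≋ x
      shift x = begin
        x + c + c⁻          ≡⟨ +-assoc x c c⁻ ⟩
        x + (c + c⁻)        ≈⟨ +-congˡ x (+-cong (%-≋ c) ≋-refl) ⟨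
        x + (c % n + c⁻)    ≡⟨ cong (x +_) (m+[n∸m]≡n (m%n≤n c n)) ⟩
        x + n               ≈⟨ %≡⇒≋ ([m+n]%n≡m%n x n) ⟩
        x                   ∎

  module CongruencePrime (n : ℕ) .{{_ : NonZero n}} (prime : Prime n) where
    open Congruence n
    open ≋-Reasoning

    ∣-cancelˡ : ∀ {a b} → n ∤ a → n ∣ a * b → n ∣ b
    ∣-cancelˡ {a} {b} n∤a n∣ab with euclidsLemma a b prime n∣ab
    ... | inj₁ n∣a = ⊥-elim (n∤a n∣a)
    ... | inj₂ n∣b = n∣b

    *-∤ : ∀ {a b} → n ∤ a → n ∤ b → n ∤ a * b
    *-∤ n∤a n∤b = n∤b ∘ ∣-cancelˡ n∤a

    n∤1 : n ∤ 1
    n∤1 n∣1 = <-irrefl (sym (∣1⇒≡1 n∣1)) (nonTrivial⇒n>1 n {{prime⇒nonTrivial prime}})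

    ∏-∤ : ∀ {L} (f : Fin L → ℕ) → (∀ i → n ∤ f i) → n ∤ ∏ f
    ∏-∤ {zero}  f _   = n∤1
    ∏-∤ {suc L} f n∤f = *-∤ (n∤f zero) (∏-∤ (f ∘ suc) (n∤f ∘ suc))

    -- In the second Bézout case t = a * y is ≋ -1, and then t * t ≋ 1 since t * t + t = t * (1 + t) ≋ 0 ≋ 1 + t.
    inverse : ∀ {a} → n ∤ a → ∃ λ b → a * b ≋ 1
    inverse {a} n∤a with coprime-Bézout (prime⇒coprime prime {{r≢0}} (m%n<n a n))
      where
      r≢0 : NonZero (a % n)
      r≢0 = ≢-nonZero (λ r≡0 → n∤a (m%n≡0⇒n∣m a n r≡0))
    ... | Bézout.-+ x y eq = y , (begin
      a * y            ≈⟨ *-cong (%-≋ a) ≋-refl ⟨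
      a % n * y        ≡⟨ *-comm (a % n) y ⟩
      y * (a % n)      ≡⟨ eq ⟨
      1 + x * n        ≈⟨ +-congˡ 1 (∣⇒≋0 (n∣m*n x)) ⟩
      1 + 0            ∎)
    ... | Bézout.+- x y eq = y * t , +-cancelʳ-≋ t (begin
      a * (y * t) + t  ≡⟨ cong (_+ t) (*-assoc a y t) ⟨
      t * t + t        ≡⟨ +-comm (t * t) t ⟩
      t + t * t        ≡⟨ *-suc t t ⟨
      t * (1 + t)      ≈⟨ *-congˡ t t+1≋0 ⟩
      t * 0            ≡⟨ *-zeroʳ t ⟩
      0                ≈⟨ t+1≋0 ⟨
      1 + t            ∎)
      where
      t = a * y
      t+1≋0 : 1 + t ≋ 0
      t+1≋0 = begin
        1 + a * y          ≈⟨ +-congˡ 1 (*-cong (%-≋ a) ≋-refl) ⟨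
        1 + a % n * y      ≡⟨ cong (1 +_) (*-comm (a % n) y) ⟩
        1 + y * (a % n)    ≡⟨ eq ⟩
        x * n              ≈⟨ ∣⇒≋0 (n∣m*n x) ⟩
        0                  ∎

    inverse-∤ : ∀ {a b} → a * b ≋ 1 → n ∤ b
    inverse-∤ {a} ab≋1 n∣b = n∤1 (∣-resp-≋ ab≋1 (∣n⇒∣m*n a n∣b))

    *-cancelʳ-≋ : ∀ {a b c} → n ∤ c → a * c ≋ b * c → a ≋ b
    *-cancelʳ-≋ {a} {b} {c} n∤c ac≋bc with c⁻¹ , cc⁻¹≋1 ← inverse n∤c = begin
      a                ≡⟨ *-identityʳ a ⟨
      a * 1            ≈⟨ *-congˡ a cc⁻¹≋1 ⟨
      a * (c * c⁻¹)    ≡⟨ *-assoc a c c⁻¹ ⟨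
      a * c * c⁻¹      ≈⟨ *-cong ac≋bc ≋-refl ⟩
      b * c * c⁻¹      ≡⟨ *-assoc b c c⁻¹ ⟩
      b * (c * c⁻¹)    ≈⟨ *-congˡ b cc⁻¹≋1 ⟩
      b * 1            ≡⟨ *-identityʳ b ⟩
      b                ∎

  module Residues (k : ℕ) (prime : Prime (suc k)) where
    private
      n = suc k
    open Congruence n
    open CongruencePrime n prime
    open ≋-Reasoning

    res : Fin k → ℕ
    res i = suc (toℕ i)

    0<k : 0 < k
    0<k = s≤s⁻¹ (nonTrivial⇒n>1 n {{prime⇒nonTrivial prime}})

    res-∤ : ∀ i → n ∤ res i
    res-∤ i = >⇒∤ (s≤s (toℕ<n i))

    res<n : ∀ i → res i < n
    res<n i = s≤s (toℕ<n i)

    res-injective : ∀ {i j} → res i ≋ res j → i ≡ j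
    res-injective {i} {j} = toℕ-injective ∘ suc-injective ∘ ≋∧<⇒≡ (res<n i) (res<n j)

    res-surjective : ∀ {a} → n ∤ a → ∃ λ i → a ≋ res i
    res-surjective {a} n∤a with a % n in eq | m%n<n a n
    ... | zero  | _       = ⊥-elim (n∤a (m%n≡0⇒n∣m a n eq))
    ... | suc r | s≤s r<k = fromℕ< r<k , %≡⇒≋ (trans eq (sym (trans (m<n⇒m%n≡m (res<n (fromℕ< r<k))) (cong suc (toℕ-fromℕ< r<k)))))

    ∏-residueSystem : (ℓ : Fin k → ℕ) → (∀ f → ∃ λ i → ℓ i ≋ res f) → ∏ ℓ ≋ ∏ res
    ∏-residueSystem ℓ hits = begin
      ∏ ℓ          ≡⟨ ∏-permute ℓ π ⟩
      ∏ (ℓ ∘ g)    ≈⟨ ∏-cong (proj₂ ∘ hits) ⟩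
      ∏ res        ∎
      where
      g : Fin k → Fin k
      g = proj₁ ∘ hits
      g-injective : Injective _≡_ _≡_ g
      g-injective {x} {y} gx≡gy = res-injective (begin
        res x        ≈⟨ proj₂ (hits x) ⟨
        ℓ (g x)      ≡⟨ cong ℓ gx≡gy ⟩
        ℓ (g y)      ≈⟨ proj₂ (hits y) ⟩
        res y        ∎)
      g⁻¹ : Fin k → Fin k
      g⁻¹ = proj₁ ∘ injective⇒surjective g g-injective
      π : Permutation k k
      π = permutation g g⁻¹ (proj₂ ∘ injective⇒surjective g g-injective)
                            (λ x → g-injective (proj₂ (injective⇒surjective g g-injective (g x))))

    fermat : ∀ {a} → n ∤ a → a ^ k ≋ 1
    fermat {a} n∤a with a⁻¹ , aa⁻¹≋1 ← inverse n∤a = *-cancelʳ-≋ (∏-∤ res res-∤) (begin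
      a ^ k * ∏ res              ≡⟨ cong (_* ∏ res) (∏-const k a) ⟨
      ∏ {k} (λ _ → a) * ∏ res       ≡⟨ ∏-distrib-* (λ _ → a) res ⟨
      ∏ (λ i → a * res i)        ≈⟨ ∏-residueSystem (λ i → a * res i) hits ⟩
      ∏ res                      ≡⟨ *-identityˡ (∏ res) ⟨
      1 * ∏ res                  ∎)
      where
      hits : ∀ f → ∃ λ i → a * res i ≋ res f
      hits f with i , a⁻¹f≋i ← res-surjective (*-∤ {a⁻¹} (inverse-∤ {a} aa⁻¹≋1) (res-∤ f)) = i , (begin
        a * res i              ≈⟨ *-congˡ a a⁻¹f≋i ⟨
        a * (a⁻¹ * res f)      ≡⟨ *-assoc a a⁻¹ (res f) ⟨
        a * a⁻¹ * res f        ≈⟨ *-cong aa⁻¹≋1 ≋-refl ⟩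
        1 * res f              ≡⟨ *-identityˡ (res f) ⟩
        res f                  ∎)

  module PowerSums (k : ℕ) (prime : Prime (suc k)) where
    private
      n = suc k
    open Congruence n
    open CongruencePrime n prime
    open Residues k prime using (res; res-∤; 0<k; fermat)
    open ≋-Reasoning

    powerSum : ℕ → ℕ
    powerSum e = ∑[ σ < n ] (toℕ σ ^ e)

    ∑-pow*∏-linear : ∀ {L} (a b : Fin L → ℕ) j → (∀ e → e < j + L → powerSum e ≋ 0) →
                     ∑[ σ < n ] (toℕ σ ^ j * ∏ (λ i → a i * toℕ σ + b i)) ≋ ∏ a * powerSum (j + L)
    ∑-pow*∏-linear {zero} a b j _ = begin
      ∑[ σ < n ] (toℕ σ ^ j * 1)  ≡⟨ sum-cong-≗ {n} (λ σ → *-identityʳ (toℕ σ ^ j)) ⟩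
      powerSum j                  ≡⟨ cong powerSum (+-identityʳ j) ⟨
      powerSum (j + 0)            ≡⟨ +-identityʳ _ ⟨
      1 * powerSum (j + 0)        ∎
    ∑-pow*∏-linear {suc L} a b j vanish = begin
      ∑[ σ < n ] (toℕ σ ^ j * ((a₀ * toℕ σ + b₀) * P (toℕ σ)))
        ≡⟨ sum-cong-≗ {n} (λ σ → expand (toℕ σ ^ j) (toℕ σ) (P (toℕ σ))) ⟩
      ∑[ σ < n ] (a₀ * (toℕ σ ^ suc j * P (toℕ σ)) + b₀ * (toℕ σ ^ j * P (toℕ σ)))
        ≡⟨ ∑-distrib-+ {n} (λ σ → a₀ * (toℕ σ ^ suc j * P (toℕ σ))) (λ σ → b₀ * (toℕ σ ^ j * P (toℕ σ))) ⟩
      ∑[ σ < n ] (a₀ * (toℕ σ ^ suc j * P (toℕ σ))) + ∑[ σ < n ] (b₀ * (toℕ σ ^ j * P (toℕ σ)))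
        ≡⟨ cong₂ _+_ (*-distribˡ-sum {n} a₀ (λ σ → toℕ σ ^ suc j * P (toℕ σ))) (*-distribˡ-sum {n} b₀ (λ σ → toℕ σ ^ j * P (toℕ σ))) ⟨
      a₀ * ∑[ σ < n ] (toℕ σ ^ suc j * P (toℕ σ)) + b₀ * ∑[ σ < n ] (toℕ σ ^ j * P (toℕ σ))
        ≈⟨ +-cong (*-congˡ a₀ (∑-pow*∏-linear a′ b′ (suc j) vanish′))
                  (*-congˡ b₀ (∑-pow*∏-linear a′ b′ j (λ e → vanish′ e ∘ m<n⇒m<1+n))) ⟩
      a₀ * (∏ a′ * powerSum (suc j + L)) + b₀ * (∏ a′ * powerSum (j + L))
        ≈⟨ +-congˡ (a₀ * (∏ a′ * powerSum (suc j + L))) (*-congˡ b₀ (*-congˡ (∏ a′) (vanish′ (j + L) (n<1+n _)))) ⟩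
      a₀ * (∏ a′ * powerSum (suc j + L)) + b₀ * (∏ a′ * 0)
        ≡⟨ collect a₀ b₀ (∏ a′) (powerSum (suc j + L)) ⟩
      ∏ a * powerSum (suc j + L)
        ≡⟨ cong (λ e → ∏ a * powerSum e) (+-suc j L) ⟨
      ∏ a * powerSum (j + suc L)  ∎
      where
      a₀ = a zero
      b₀ = b zero
      a′ = a ∘ suc
      b′ = b ∘ suc
      P : ℕ → ℕ
      P x = ∏ (λ i → a′ i * x + b′ i)
      expand : ∀ y x z → y * ((a₀ * x + b₀) * z) ≡ a₀ * ((x * y) * z) + b₀ * (y * z)
      expand = ring a₀ b₀
        where
        ring : ∀ a b y x z → y * ((a * x + b) * z) ≡ a * ((x * y) * z) + b * (y * z)
        ring = solve-∀
      collect : ∀ a b c x → a * (c * x) + b * (c * 0) ≡ a * c * x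
      collect = solve-∀
      vanish′ : ∀ e → e < suc (j + L) → powerSum e ≋ 0
      vanish′ e = vanish e ∘ subst (e <_) (sym (+-suc j L))

    powerSum-≋0 : ∀ {e} → e < k → powerSum e ≋ 0
    powerSum-≋0 {e} = <-rec (λ e → e < k → powerSum e ≋ 0) step e
      where
      step : ∀ e → (∀ {d} → d < e → d < k → powerSum d ≋ 0) → e < k → powerSum e ≋ 0
      step zero _ _ = begin
        powerSum 0   ≡⟨ ∑-1 n ⟩
        n            ≈⟨ ∣⇒≋0 ∣-refl ⟩
        0            ∎
      step (suc e) rec 1+e<k = begin
        powerSum (suc e)                                  ≡⟨ *-identityˡ _ ⟨
        1 * powerSum (suc e)                              ≡⟨ cong (_* powerSum (suc e)) (trans (∏-const (suc e) 1) (^-zeroˡ (suc e))) ⟨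
        ∏ {suc e} (λ _ → 1) * powerSum (0 + suc e)        ≈⟨ ∑-pow*∏-linear {suc e} (λ _ → 1) toℕ 0 (λ d d<1+e → rec d<1+e (<-trans d<1+e 1+e<k)) ⟨
        ∑[ σ < n ] (1 * ∏ {suc e} (λ i → 1 * toℕ σ + toℕ i)) ≡⟨ sum-cong-≗ {n} (λ σ → rising σ) ⟨
        X                                                 ≈⟨ ∣⇒≋0 n∣X ⟩
        0                                                 ∎
        where
        X = ∑[ σ < n ] (toℕ σ ↑ suc e)
        rising : ∀ σ → toℕ σ ↑ suc e ≡ 1 * ∏ {suc e} (λ i → 1 * toℕ σ + toℕ i)
        rising σ = trans (↑-∏ (toℕ σ) (suc e))
                    (sym (trans (*-identityˡ _) (∏-cong-≗ {suc e} (λ i → cong (_+ toℕ i) (*-identityˡ (toℕ σ))))))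
        n∣X : n ∣ X
        n∣X = ∣-cancelˡ (>⇒∤ (s≤s 1+e<k)) (subst (n ∣_) (sym (∑-↑ e k)) (∣n⇒∣m*n k (m∣m*n (suc n ↑ e))))

    powerSum-k : powerSum k ≋ k
    powerSum-k = begin
      powerSum k                       ≡⟨ cong (_+ ∑[ i < k ] (res i ^ k)) (0^k≡0 0<k) ⟩
      ∑[ i < k ] (res i ^ k)           ≈⟨ ∑-cong (λ i → fermat (res-∤ i)) ⟩
      ∑[ i < k ] 1                     ≡⟨ ∑-1 k ⟩
      k                                ∎
      where
      0^k≡0 : ∀ {m} → 0 < m → 0 ^ m ≡ 0
      0^k≡0 {suc _} _ = refl

  module Lines (k : ℕ) (prime : Prime (suc k)) (w : Fin k → ℕ) where
    private
      n = suc k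
    open Congruence n
    open CongruencePrime n prime
    open Residues k prime
    open PowerSums k prime
    open ≋-Reasoning

    ℓ : ℕ → Fin k → ℕ
    ℓ σ i = res i * σ + w i

    HasRoot : ℕ → Set
    HasRoot σ = ∃ λ i → n ∣ ℓ σ i

    Avoids : ℕ → Fin k → Set
    Avoids σ f = ∀ i → n ∤ ℓ σ i × ¬ ℓ σ i ≋ res f

    root-exists : ∀ i → ∃ λ (σ : Fin n) → n ∣ ℓ (toℕ σ) i
    root-exists i with r⁻¹ , rr⁻¹≋1 ← inverse (res-∤ i) = fromℕ< (m%n<n σ n) , ≋0⇒∣ (begin
      res i * toℕ (fromℕ< (m%n<n σ n)) + w i   ≡⟨ cong (λ x → res i * x + w i) (toℕ-fromℕ< (m%n<n σ n)) ⟩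
      res i * (σ % n) + w i                    ≈⟨ +-cong (*-congˡ (res i) (%-≋ σ)) (≋-sym (%-≋ (w i))) ⟩
      res i * (-w * r⁻¹) + w i % n             ≡⟨ cong (_+ w i % n) (rearrange (res i) -w r⁻¹) ⟩
      -w * (res i * r⁻¹) + w i % n             ≈⟨ +-cong (*-congˡ -w rr⁻¹≋1) ≋-refl ⟩
      -w * 1 + w i % n                         ≡⟨ cong (_+ w i % n) (*-identityʳ -w) ⟩
      -w + w i % n                             ≡⟨ m∸n+n≡m (m%n≤n (w i) n) ⟩
      n                                        ≈⟨ ∣⇒≋0 ∣-refl ⟩
      0                                        ∎)
      where
      -w = n ∸ w i % n
      σ = -w * r⁻¹
      rearrange : ∀ x y z → x * (y * z) ≡ y * (x * z)
      rearrange = solve-∀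

    ∑-∏ℓ : ∑[ σ < n ] ∏ (ℓ (toℕ σ)) ≋ ∏ res * k
    ∑-∏ℓ = begin
      ∑[ σ < n ] ∏ (ℓ (toℕ σ))                 ≡⟨ sum-cong-≗ {n} (λ σ → *-identityˡ (∏ (ℓ (toℕ σ)))) ⟨
      ∑[ σ < n ] (toℕ σ ^ 0 * ∏ (ℓ (toℕ σ)))   ≈⟨ ∑-pow*∏-linear res w 0 (λ _ → powerSum-≋0) ⟩
      ∏ res * powerSum k                        ≈⟨ *-congˡ (∏ res) powerSum-k ⟩
      ∏ res * k                                 ∎

    hasRoot? : ∀ σ → Dec (HasRoot σ)
    hasRoot? σ = any? (λ i → n ∣? ℓ σ i)

    avoids? : ∀ σ f → Dec (Avoids σ f)
    avoids? σ f = all? (λ i → ¬? (n ∣? ℓ σ i) ×-dec ¬? (ℓ σ i ≋? res f))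

    rootFreeIndicator : ℕ → ℕ
    rootFreeIndicator σ with hasRoot? σ
    ... | yes _ = 0
    ... | no  _ = 1

    rootFreeIndicator≤1 : ∀ σ → rootFreeIndicator σ ≤ 1
    rootFreeIndicator≤1 σ with hasRoot? σ
    ... | yes _ = z≤n
    ... | no  _ = ≤-refl

    rootFreeIndicator-root : ∀ {σ} → HasRoot σ → rootFreeIndicator σ ≡ 0
    rootFreeIndicator-root {σ} root with hasRoot? σ
    ... | yes _     = refl
    ... | no  ¬root = ⊥-elim (¬root root)

    ∏ℓ-unavoidable : ∀ σ → (∀ f → ¬ Avoids σ f) → ∏ (ℓ σ) ≋ ∏ res * rootFreeIndicator σ
    ∏ℓ-unavoidable σ unavoidable with hasRoot? σ
    ... | yes (i , n∣ℓi) = begin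
      ∏ (ℓ σ)       ≈⟨ ∣⇒≋0 (∏-∣ (ℓ σ) i n∣ℓi) ⟩
      0             ≡⟨ *-zeroʳ (∏ res) ⟨
      ∏ res * 0     ∎
    ... | no ¬root = begin
      ∏ (ℓ σ)       ≈⟨ ∏-residueSystem (ℓ σ) hits ⟩
      ∏ res         ≡⟨ *-identityʳ (∏ res) ⟨
      ∏ res * 1     ∎
      where
      hits : ∀ f → ∃ λ i → ℓ σ i ≋ res f
      hits f with any? (λ i → ℓ σ i ≋? res f)
      ... | yes hit  = hit
      ... | no  miss = ⊥-elim (unavoidable f (λ i → (λ n∣ℓi → ¬root (i , n∣ℓi)) , (λ ℓi≋f → miss (i , ℓi≋f))))

    -- If no σ avoids, then ∏ (ℓ σ) ≋ ∏ res for every root-free σ (the values of ℓ σ run through all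
    -- nonzero residues), so by ∑-∏ℓ the number of root-free σ is ≋ k: only one σ has a root.
    avoidance : ∀ {j i₀} → (∀ {σ} → n ∣ ℓ σ j → n ∤ ℓ σ i₀) → ∃₂ λ σ f → Avoids σ f
    avoidance {j} {i₀} noCommonRoot with any? (λ σ → any? (λ f → avoids? (toℕ σ) f))
    ... | yes (σ , f , avoids) = toℕ σ , f , avoids
    ... | no  none = ⊥-elim (1+n≰n (subst (λ c → 2 + c ≤ n) count≡k count+2≤n))
      where
      count = ∑[ σ < n ] rootFreeIndicator (toℕ σ)
      count≋k : count ≋ k
      count≋k = *-cancelʳ-≋ (∏-∤ res res-∤) (begin
        count * ∏ res                           ≡⟨ *-comm count (∏ res) ⟩
        ∏ res * count                           ≡⟨ *-distribˡ-sum {n} (∏ res) (rootFreeIndicator ∘ toℕ) ⟩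
        ∑[ σ < n ] (∏ res * rootFreeIndicator (toℕ σ))   ≈⟨ ∑-cong {n} (λ σ → ∏ℓ-unavoidable (toℕ σ) (λ f av → none (σ , f , av))) ⟨
        ∑[ σ < n ] ∏ (ℓ (toℕ σ))                ≈⟨ ∑-∏ℓ ⟩
        ∏ res * k                               ≡⟨ *-comm (∏ res) k ⟩
        k * ∏ res                               ∎)
      count+2≤n : 2 + count ≤ n
      count+2≤n = ∑-≤-two-zeros (rootFreeIndicator ∘ toℕ) (rootFreeIndicator≤1 ∘ toℕ) σ₁≢σ₂
                    (rootFreeIndicator-root (j , proj₂ (root-exists j))) (rootFreeIndicator-root (i₀ , proj₂ (root-exists i₀)))
        where
        σ₁≢σ₂ : proj₁ (root-exists j) ≢ proj₁ (root-exists i₀)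
        σ₁≢σ₂ σ₁≡σ₂ = noCommonRoot (proj₂ (root-exists j)) (subst (λ σ → n ∣ ℓ (toℕ σ) i₀) (sym σ₁≡σ₂) (proj₂ (root-exists i₀)))
      count≡k : count ≡ k
      count≡k = ≋∧<⇒≡ (≤-trans (n≤1+n (suc count)) count+2≤n) ≤-refl count≋k

  gcdFin-greatest : ∀ {d} k (u : Fin k → ℕ) → (∀ i → d ∣ u i) → d ∣ gcdFin k u
  gcdFin-greatest zero    u d∣u = _ ∣0
  gcdFin-greatest (suc k) u d∣u = gcd-greatest (d∣u zero) (gcdFin-greatest k (u ∘ suc) (d∣u ∘ suc))

  FarFromMultiples : (N : ℕ) .{{_ : NonZero N}} → ℕ → ℕ → Set
  FarFromMultiples N d x = d ≤ x % N × x % N + d ≤ N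

  farFromMultiples-digit : ∀ n p .{{_ : NonZero n}} .{{_ : NonZero p}} .{{_ : NonZero (n * p)}} {R c} → c < p →
                           1 ≤ R % n → R % n * p + c + p ≤ n * p → FarFromMultiples (n * p) p (R * p + c)
  farFromMultiples-digit n p {R} {c} c<p 1≤R%n bound = subst (λ r → p ≤ r × r + p ≤ n * p) (sym digit) (lower , bound)
    where
    digit : (R * p + c) % (n * p) ≡ R % n * p + c
    digit = trans ([m*n+o]%[p*n]≡[m*n]%[p*n]+o R n c<p) (cong (_+ c) (sym (m%n*o≡m*o%[n*o] R n p)))
    lower : p ≤ R % n * p + c
    lower = ≤-trans (subst (_≤ R % n * p) (*-identityˡ p) (*-monoˡ-≤ p 1≤R%n)) (m≤m+n (R % n * p) c)

  module Dilation (k p : ℕ) .{{_ : NonZero p}} (prime : Prime (suc k)) (k*k+k<p : k * k + k < p)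
                  (u : Fin k → ℕ) (u≡res : ∀ i → u i % p ≡ suc (toℕ i) % p) where
    private
      n = suc k
      instance
        n*p≢0 : NonZero (n * p)
        n*p≢0 = m*n≢0 n p
    open Congruence n
    open CongruencePrime n prime
    open Residues k prime

    Far : ℕ → Set
    Far = FarFromMultiples (n * p) p

    w : Fin k → ℕ
    w i = u i / p

    open Lines k prime w
    open ≋-Reasoning

    k<p : k < p
    k<p = ≤-<-trans (m≤n+m k (k * k)) k*k+k<p

    u-expand : ∀ i → u i ≡ res i + w i * p
    u-expand i = trans (m≡m%n+[m/n]*n (u i) p)
                       (cong (_+ w i * p) (trans (u≡res i) (m<n⇒m%n≡m (≤-<-trans (toℕ<n i) k<p))))

    ∤⇒1≤% : ∀ {a} → n ∤ a → 1 ≤ a % n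
    ∤⇒1≤% {a} n∤a = n≢0⇒n>0 (λ a%n≡0 → n∤a (m%n≡0⇒n∣m a n a%n≡0))

    dilation-all-∤ : (∀ i → n ∤ u i) → ∀ i → Far (p * u i)
    dilation-all-∤ n∤u i = subst Far (trans (+-identityʳ (u i * p)) (*-comm (u i) p))
      (farFromMultiples-digit n p {u i} (n≢0⇒n>0 (≢-nonZero⁻¹ p)) (∤⇒1≤% (n∤u i)) bound)
      where
      bound : u i % n * p + 0 + p ≤ n * p
      bound = subst (_≤ n * p) (trans (+-comm p _) (cong (_+ p) (sym (+-identityʳ _))))
                    (*-monoˡ-≤ p (m%n<n (u i) n))

    shift : ∀ σ i → u i + σ * p * res i ≡ res i + p * ℓ σ i
    shift σ i = trans (cong (_+ σ * p * res i) (u-expand i)) (ring (res i) (w i) σ p)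
      where
      ring : ∀ r w σ p → r + w * p + σ * p * r ≡ r + p * (r * σ + w)
      ring = solve-∀

    shift-root : ∀ {σ i} → n ∣ ℓ σ i → u i + σ * p * res i ≋ res i
    shift-root {σ} {i} n∣ℓ = begin
      u i + σ * p * res i    ≡⟨ shift σ i ⟩
      res i + p * ℓ σ i      ≈⟨ +-congˡ (res i) (*-congˡ p (∣⇒≋0 n∣ℓ)) ⟩
      res i + p * 0          ≡⟨ cong (res i +_) (*-zeroʳ p) ⟩
      res i + 0              ≡⟨ +-identityʳ (res i) ⟩
      res i                  ∎

    -- At a common root σ of ℓ j and ℓ i₀, shift-root and u j ≋ 0 force σ * p ≋ 1, and then u i₀ ≋ 0.
    noCommonRoot : ∀ {j i₀} → n ∣ u j → n ∤ u i₀ → ∀ {σ} → n ∣ ℓ σ j → n ∤ ℓ σ i₀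
    noCommonRoot {j} {i₀} n∣uj n∤ui₀ {σ} n∣ℓj n∣ℓi₀ = n∤ui₀ (≋0⇒∣ (+-cancelʳ-≋ (res i₀) (begin
      u i₀ + res i₀               ≡⟨ cong (u i₀ +_) (*-identityˡ (res i₀)) ⟨
      u i₀ + 1 * res i₀           ≈⟨ +-congˡ (u i₀) (*-cong σp≋1 ≋-refl) ⟨
      u i₀ + σ * p * res i₀       ≈⟨ shift-root n∣ℓi₀ ⟩
      res i₀                      ≡⟨⟩
      0 + res i₀                  ∎)))
      where
      σp≋1 : σ * p ≋ 1
      σp≋1 = *-cancelʳ-≋ (res-∤ j) (begin
        σ * p * res j           ≈⟨ +-cong (∣⇒≋0 n∣uj) ≋-refl ⟨
        u j + σ * p * res j     ≈⟨ shift-root n∣ℓj ⟩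
        res j                   ≡⟨ *-identityˡ (res j) ⟨
        1 * res j               ∎)

    -- μ ≋ -(res f)⁻¹ and m = s * p + ρ ≋ μ, so the n-digits R i of m * u i = R i * p + ρ * res i are
    -- ≋ μ * ℓ σ i ∉ {0, -1}, while ρ * res i ≤ k * k < p.
    module Avoiding {σ : ℕ} {f : Fin k} (avoids : Avoids σ f) where
      f⁻¹ : ℕ
      f⁻¹ = proj₁ (inverse (res-∤ f))

      μ : ℕ
      μ = k * f⁻¹

      μ*res-f≋k : μ * res f ≋ k
      μ*res-f≋k = begin
        k * f⁻¹ * res f        ≡⟨ *-assoc k f⁻¹ (res f) ⟩
        k * (f⁻¹ * res f)      ≡⟨ cong (k *_) (*-comm f⁻¹ (res f)) ⟩
        k * (res f * f⁻¹)      ≈⟨ *-congˡ k (proj₂ (inverse (res-∤ f))) ⟩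
        k * 1                  ≡⟨ *-identityʳ k ⟩
        k                      ∎

      n∤μ : n ∤ μ
      n∤μ = *-∤ (>⇒∤ {{>-nonZero 0<k}} (n<1+n k)) (inverse-∤ {res f} (proj₂ (inverse (res-∤ f))))

      s ρ m : ℕ
      s = μ * σ
      ρ = (μ + k * (s * p)) % n
      m = s * p + ρ

      R : Fin k → ℕ
      R i = s * u i + ρ * w i

      m≋μ : m ≋ μ
      m≋μ = begin
        s * p + ρ                    ≈⟨ +-congˡ (s * p) (%-≋ (μ + k * (s * p))) ⟩
        s * p + (μ + k * (s * p))    ≡⟨ ring (s * p) μ k ⟩
        μ + (s * p) * n              ≈⟨ +-congˡ μ (∣⇒≋0 (n∣m*n (s * p))) ⟩
        μ + 0                        ≡⟨ +-identityʳ μ ⟩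
        μ                            ∎
        where
        ring : ∀ x μ k → x + (μ + k * x) ≡ μ + x * suc k
        ring = solve-∀

      R≋μℓ : ∀ i → R i ≋ μ * ℓ σ i
      R≋μℓ i = begin
        s * u i + ρ * w i              ≡⟨ cong (λ x → s * x + ρ * w i) (u-expand i) ⟩
        s * (res i + w i * p) + ρ * w i ≡⟨ ring s ρ (res i) (w i) p ⟩
        s * res i + m * w i            ≈⟨ +-congˡ (s * res i) (*-cong m≋μ ≋-refl) ⟩
        μ * σ * res i + μ * w i        ≡⟨ ring′ μ σ (res i) (w i) ⟩
        μ * ℓ σ i                      ∎
        where
        ring : ∀ s ρ r w p → s * (r + w * p) + ρ * w ≡ s * r + (s * p + ρ) * w
        ring = solve-∀
        ring′ : ∀ μ σ r w → μ * σ * r + μ * w ≡ μ * (r * σ + w)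
        ring′ = solve-∀

      m*u≡ : ∀ i → m * u i ≡ R i * p + ρ * res i
      m*u≡ i = trans (cong (m *_) (u-expand i))
               (trans (ring s ρ (res i) (w i) p) (cong (λ x → (s * x + ρ * w i) * p + ρ * res i) (sym (u-expand i))))
        where
        ring : ∀ s ρ r w p → (s * p + ρ) * (r + w * p) ≡ (s * (r + w * p) + ρ * w) * p + ρ * r
        ring = solve-∀

      R-∤ : ∀ i → n ∤ R i
      R-∤ i n∣R = *-∤ n∤μ (proj₁ (avoids i)) (∣-resp-≋ (R≋μℓ i) n∣R)

      R≉k : ∀ i → ¬ R i ≋ k
      R≉k i R≋k = proj₂ (avoids i) (*-cancelʳ-≋ n∤μ (begin
        ℓ σ i * μ       ≡⟨ *-comm (ℓ σ i) μ ⟩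
        μ * ℓ σ i       ≈⟨ R≋μℓ i ⟨
        R i             ≈⟨ R≋k ⟩
        k               ≈⟨ μ*res-f≋k ⟨
        μ * res f       ≡⟨ *-comm μ (res f) ⟩
        res f * μ       ∎))

      R%n<k : ∀ i → R i % n < k
      R%n<k i = ≤∧≢⇒< (s≤s⁻¹ (m%n<n (R i) n)) (λ R%n≡k → R≉k i (%≡⇒≋ (trans R%n≡k (sym (m<n⇒m%n≡m (n<1+n k))))))

      ρ*res<p : ∀ i → ρ * res i < p
      ρ*res<p i = ≤-<-trans (*-mono-≤ (s≤s⁻¹ (m%n<n (μ + k * (s * p)) n)) (toℕ<n i)) (≤-<-trans (m≤m+n (k * k) k) k*k+k<p)

      far : ∀ i → Far (m * u i)
      far i = subst Far (sym (m*u≡ i)) (farFromMultiples-digit n p {R i} (ρ*res<p i) (∤⇒1≤% (R-∤ i)) bound)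
        where
        bound : R i % n * p + ρ * res i + p ≤ n * p
        bound = ≤-trans (+-monoˡ-≤ p (+-monoʳ-≤ (R i % n * p) (<⇒≤ (ρ*res<p i))))
                        (subst (_≤ n * p) (ring (R i % n) p) (*-monoˡ-≤ p (s≤s (R%n<k i))))
          where
          ring : ∀ a p → (2 + a) * p ≡ a * p + p + p
          ring = solve-∀

    dilation-some-∣ : ∀ {j i₀} → n ∣ u j → n ∤ u i₀ → ∃ λ m → ∀ i → Far (m * u i)
    dilation-some-∣ n∣uj n∤ui₀ = dilate (avoidance (noCommonRoot n∣uj n∤ui₀))
      where
      dilate : (∃₂ λ σ f → Avoids σ f) → ∃ λ m → ∀ i → Far (m * u i)
      dilate (_ , _ , avoids) = Avoiding.m avoids , Avoiding.far avoids

    dilation : gcdFin k u ≡ 1 → ∃ λ m → ∀ i → Far (m * u i)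
    dilation gcd≡1 with any? (λ i → n ∣? u i)
    ... | no none = p , dilation-all-∤ (λ i n∣ui → none (i , n∣ui))
    ... | yes (j , n∣uj) with all? (λ i → n ∣? u i)
    ...   | yes all-∣ = ⊥-elim (n∤1 (subst (n ∣_) gcd≡1 (gcdFin-greatest k u all-∣)))
    ...   | no ¬all-∣ with i₀ , n∤ui₀ ← ¬∀⟶∃¬ k _ (λ i → n ∣? u i) ¬all-∣ = dilation-some-∣ n∣uj n∤ui₀


module Fractions where

  open import Defs using (‖_‖)
  open NumberTheory using (FarFromMultiples)

  open import Data.Nat as ℕ using (ℕ; suc; NonZero)
  import Data.Nat.Properties as ℕ
  import Data.Nat.DivMod as ℕ
  open import Data.Product using (_,_)
  open import Data.Integer as ℤ using (ℤ; +_; +[1+_]; 1ℤ) renaming (suc to sucℤ)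
  import Data.Integer.Properties as ℤ
  import Data.Integer.DivMod as ℤ
  open import Data.Integer.Tactic.RingSolver using (solve-∀)
  open import Data.Rational using (ℚ; mkℚ; _/_; _-_; -_; _*_; _≤_; _⊓_; floor; ceiling; ↥_; ↧_; toℚᵘ)
  import Data.Rational.Properties as ℚ
  open import Data.Rational.Unnormalised as ℚᵘ using (mkℚᵘ; *≤*) renaming (_≃_ to _≃ᵘ_; _/_ to _/ᵘ_)
  import Data.Rational.Unnormalised.Properties as ℚᵘ
  open import Relation.Binary.PropositionalEquality

  toℚᵘ-/ : ∀ i N .{{_ : NonZero N}} → toℚᵘ (i / N) ≃ᵘ i /ᵘ N
  toℚᵘ-/ i (suc d) = ℚ.toℚᵘ-fromℚᵘ (mkℚᵘ i d)

  ↥/-* : ∀ i N .{{_ : NonZero N}} → ↥ (i / N) ℤ.* + N ≡ i ℤ.* ↧ (i / N)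
  ↥/-* i N@(suc _) = trans (cong (ℤ._* + N) (sym (ℚ.↥ᵘ-toℚᵘ (i / N))))
                    (trans (ℚᵘ.drop-*≡* (toℚᵘ-/ i N)) (cong (i ℤ.*_) (ℚ.↧ᵘ-toℚᵘ (i / N))))

  neg-/ : ∀ i N .{{_ : NonZero N}} → - (i / N) ≡ (ℤ.- i) / N
  neg-/ i N@(suc _) = ℚ.toℚᵘ-injective (begin
    toℚᵘ (- (i / N))        ≈⟨ ℚ.toℚᵘ-homo‿- (i / N) ⟩
    ℚᵘ.- toℚᵘ (i / N)       ≈⟨ ℚᵘ.-‿cong (toℚᵘ-/ i N) ⟩
    (ℤ.- i) /ᵘ N            ≈⟨ toℚᵘ-/ (ℤ.- i) N ⟨
    toℚᵘ ((ℤ.- i) / N)      ∎)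
    where open ℚᵘ.≃-Reasoning

  *-/1 : ∀ a b N .{{_ : NonZero N}} → (+ a / N) * (+ b / 1) ≡ + (a ℕ.* b) / N
  *-/1 a b N@(suc _) = ℚ.toℚᵘ-injective (begin
    toℚᵘ ((+ a / N) * (+ b / 1))          ≈⟨ ℚ.toℚᵘ-homo-* (+ a / N) (+ b / 1) ⟩
    toℚᵘ (+ a / N) ℚᵘ.* toℚᵘ (+ b / 1)    ≈⟨ ℚᵘ.*-cong (toℚᵘ-/ (+ a) N) (toℚᵘ-/ (+ b) 1) ⟩
    (+ a ℤ.* + b) /ᵘ (N ℕ.* 1)            ≡⟨ ℚᵘ./-cong (sym (ℤ.pos-* a b)) (ℕ.*-identityʳ N) ⟩
    + (a ℕ.* b) /ᵘ N                      ≈⟨ toℚᵘ-/ (+ (a ℕ.* b)) N ⟨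
    toℚᵘ (+ (a ℕ.* b) / N)                ∎)
    where open ℚᵘ.≃-Reasoning

  /-/1 : ∀ i j N .{{_ : NonZero N}} → i / N - j / 1 ≡ (i ℤ.- j ℤ.* + N) / N
  /-/1 i j N@(suc _) = ℚ.toℚᵘ-injective (begin
    toℚᵘ (i / N - j / 1)                         ≈⟨ ℚ.toℚᵘ-homo-+ (i / N) (- (j / 1)) ⟩
    toℚᵘ (i / N) ℚᵘ.+ toℚᵘ (- (j / 1))           ≈⟨ ℚᵘ.+-cong (toℚᵘ-/ i N) (ℚᵘ.≃-trans (ℚ.toℚᵘ-homo‿- (j / 1)) (ℚᵘ.-‿cong (toℚᵘ-/ j 1))) ⟩
    (i ℤ.* 1ℤ ℤ.+ ℤ.- j ℤ.* + N) /ᵘ (N ℕ.* 1)    ≡⟨ ℚᵘ./-cong (ring i j (+ N)) (ℕ.*-identityʳ N) ⟩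
    (i ℤ.- j ℤ.* + N) /ᵘ N                       ≈⟨ toℚᵘ-/ (i ℤ.- j ℤ.* + N) N ⟨
    toℚᵘ ((i ℤ.- j ℤ.* + N) / N)                 ∎)
    where
    open ℚᵘ.≃-Reasoning
    ring : ∀ i j N → i ℤ.* 1ℤ ℤ.+ ℤ.- j ℤ.* N ≡ i ℤ.- j ℤ.* N
    ring = solve-∀

  /1-/ : ∀ i j N .{{_ : NonZero N}} → j / 1 - i / N ≡ (j ℤ.* + N ℤ.- i) / N
  /1-/ i j N@(suc _) = ℚ.toℚᵘ-injective (begin
    toℚᵘ (j / 1 - i / N)                         ≈⟨ ℚ.toℚᵘ-homo-+ (j / 1) (- (i / N)) ⟩
    toℚᵘ (j / 1) ℚᵘ.+ toℚᵘ (- (i / N))           ≈⟨ ℚᵘ.+-cong (toℚᵘ-/ j 1) (ℚᵘ.≃-trans (ℚ.toℚᵘ-homo‿- (i / N)) (ℚᵘ.-‿cong (toℚᵘ-/ i N))) ⟩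
    (j ℤ.* + N ℤ.+ ℤ.- i ℤ.* 1ℤ) /ᵘ (1 ℕ.* N)    ≡⟨ ℚᵘ./-cong (ring i j (+ N)) (ℕ.*-identityˡ N) ⟩
    (j ℤ.* + N ℤ.- i) /ᵘ N                       ≈⟨ toℚᵘ-/ (j ℤ.* + N ℤ.- i) N ⟨
    toℚᵘ ((j ℤ.* + N ℤ.- i) / N)                 ∎)
    where
    open ℚᵘ.≃-Reasoning
    ring : ∀ i j N → j ℤ.* N ℤ.+ ℤ.- i ℤ.* 1ℤ ≡ j ℤ.* N ℤ.- i
    ring = solve-∀

  div-unique : ∀ {A z} b → z ℤ.* +[1+ b ] ℤ.≤ A → A ℤ.< sucℤ z ℤ.* +[1+ b ] → A ℤ./ +[1+ b ] ≡ z
  div-unique {A} {z} b zB≤A A<[1+z]B = ℤ.≤-antisym q≤z z≤q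
    where
    B = +[1+ b ]
    q = A ℤ./ B
    qB≤A : q ℤ.* B ℤ.≤ A
    qB≤A = ℤ.[n/d]*d≤n A B
    A<[1+q]B : A ℤ.< sucℤ q ℤ.* B
    A<[1+q]B = subst (λ q → A ℤ.< sucℤ q ℤ.* B) (sym (ℤ.div-pos-is-/ℕ A (suc b))) (ℤ.n<s[n/ℕd]*d A (suc b))
    z≤q : z ℤ.≤ q
    z≤q = ℤ.≮⇒≥ λ q<z → ℤ.<⇒≱ A<[1+q]B (ℤ.≤-trans (ℤ.*-monoʳ-≤-nonNeg B (ℤ.i<j⇒suc[i]≤j q<z)) zB≤A)
    q≤z : q ℤ.≤ z
    q≤z = ℤ.≮⇒≥ λ z<q → ℤ.<⇒≱ A<[1+z]B (ℤ.≤-trans (ℤ.*-monoʳ-≤-nonNeg B (ℤ.i<j⇒suc[i]≤j z<q)) qB≤A)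

  floor≡↥/↧ : ∀ x → floor x ≡ ↥ x ℤ./ ↧ x
  floor≡↥/↧ (mkℚ _ _ _) = refl

  -- floor acts on the reduced fraction, so the bounds are transferred by cross-multiplying with ↧ (i / N).
  floor-unique : ∀ i N .{{_ : NonZero N}} {z} → z ℤ.* + N ℤ.≤ i → i ℤ.< sucℤ z ℤ.* + N → floor (i / N) ≡ z
  floor-unique i N@(suc _) {z} zN≤i i<[1+z]N = trans (floor≡↥/↧ x) (div-unique (ℚ.denominator-1 x) zD≤↥x ↥x<[1+z]D)
    where
    open ℤ.≤-Reasoning
    x = i / N
    D = ↧ x
    swap : ∀ a b c → a ℤ.* b ℤ.* c ≡ a ℤ.* c ℤ.* b
    swap = solve-∀
    zD≤↥x : z ℤ.* D ℤ.≤ ↥ x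
    zD≤↥x = ℤ.*-cancelʳ-≤-pos (z ℤ.* D) (↥ x) (+ N) (begin
      z ℤ.* D ℤ.* + N     ≡⟨ swap z D (+ N) ⟩
      z ℤ.* + N ℤ.* D     ≤⟨ ℤ.*-monoʳ-≤-nonNeg D zN≤i ⟩
      i ℤ.* D             ≡⟨ ↥/-* i N ⟨
      ↥ x ℤ.* + N         ∎)
    ↥x<[1+z]D : ↥ x ℤ.< sucℤ z ℤ.* D
    ↥x<[1+z]D = ℤ.*-cancelʳ-<-nonNeg (+ N) (begin-strict
      ↥ x ℤ.* + N             ≡⟨ ↥/-* i N ⟩
      i ℤ.* D                 <⟨ ℤ.*-monoʳ-<-pos D i<[1+z]N ⟩
      sucℤ z ℤ.* + N ℤ.* D    ≡⟨ swap (sucℤ z) (+ N) D ⟩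
      sucℤ z ℤ.* D ℤ.* + N    ∎)

  ceiling≡-floor- : ∀ x → ceiling x ≡ ℤ.- floor (- x)
  ceiling≡-floor- (mkℚ _ _ _) = refl

  ceiling-unique : ∀ i N .{{_ : NonZero N}} {z} → z ℤ.* + N ℤ.< i → i ℤ.≤ sucℤ z ℤ.* + N → ceiling (i / N) ≡ sucℤ z
  ceiling-unique i N {z} zN<i i≤[1+z]N = begin-≡
    ceiling (i / N)                 ≡⟨ ceiling≡-floor- (i / N) ⟩
    ℤ.- floor (- (i / N))           ≡⟨ cong (λ x → ℤ.- floor x) (neg-/ i N) ⟩
    ℤ.- floor ((ℤ.- i) / N)         ≡⟨ cong ℤ.-_ (floor-unique (ℤ.- i) N lower upper) ⟩
    ℤ.- (ℤ.- sucℤ z)                ≡⟨ ℤ.neg-involutive (sucℤ z) ⟩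
    sucℤ z                          ∎
    where
    open ≡-Reasoning renaming (begin_ to begin-≡_)
    lower : ℤ.- sucℤ z ℤ.* + N ℤ.≤ ℤ.- i
    lower = subst (ℤ._≤ ℤ.- i) (ℤ.neg-distribˡ-* (sucℤ z) (+ N)) (ℤ.neg-mono-≤ i≤[1+z]N)
    upper : ℤ.- i ℤ.< sucℤ (ℤ.- sucℤ z) ℤ.* + N
    upper = subst (ℤ.- i ℤ.<_) (ring z (+ N)) (ℤ.neg-mono-< zN<i)
      where
      ring : ∀ z N → ℤ.- (z ℤ.* N) ≡ (1ℤ ℤ.+ ℤ.- (1ℤ ℤ.+ z)) ℤ.* N
      ring = solve-∀

  ‖/‖ : ∀ M N .{{_ : NonZero N}} → 0 ℕ.< M ℕ.% N → ‖ + M / N ‖ ≡ (+ (M ℕ.% N) / N) ⊓ (+ (N ℕ.∸ M ℕ.% N) / N)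
  ‖/‖ M N 0<r = begin
    ‖ x ‖                                                     ≡⟨ cong₂ (λ a b → (x - a / 1) ⊓ (b / 1 - x)) floor≡q ceiling≡1+q ⟩
    (x - + q / 1) ⊓ (+ suc q / 1 - x)                         ≡⟨ cong₂ _⊓_ (/-/1 (+ M) (+ q) N) (/1-/ (+ M) (+ suc q) N) ⟩
    ((+ M ℤ.- + q ℤ.* + N) / N) ⊓ ((+ suc q ℤ.* + N ℤ.- + M) / N) ≡⟨ cong₂ (λ a b → (a / N) ⊓ (b / N)) lowerGap upperGap ⟩
    (+ r / N) ⊓ (+ (N ℕ.∸ r) / N)                             ∎
    where
    open ≡-Reasoning
    x = + M / N
    q = M ℕ./ N
    r = M ℕ.% N
    M≡r+qN : + M ≡ + r ℤ.+ + q ℤ.* + N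
    M≡r+qN = trans (cong +_ (ℕ.m≡m%n+[m/n]*n M N)) (trans (ℤ.pos-+ r (q ℕ.* N)) (cong (λ y → + r ℤ.+ y) (ℤ.pos-* q N)))
    M<[1+q]N : + M ℤ.< + suc q ℤ.* + N
    M<[1+q]N = subst₂ ℤ._<_ (sym M≡r+qN) (sym (ℤ.suc-* (+ q) (+ N))) (ℤ.+-monoˡ-< (+ q ℤ.* + N) (ℤ.+<+ (ℕ.m%n<n M N)))
    floor≡q : floor x ≡ + q
    floor≡q = floor-unique (+ M) N (subst (+ q ℤ.* + N ℤ.≤_) (sym M≡r+qN) (ℤ.i≤j+i (+ q ℤ.* + N) (+ r))) M<[1+q]N
    ceiling≡1+q : ceiling x ≡ + suc q
    ceiling≡1+q = ceiling-unique (+ M) N {+ q} (subst₂ ℤ._<_ (ℤ.+-identityˡ (+ q ℤ.* + N)) (sym M≡r+qN) (ℤ.+-monoˡ-< (+ q ℤ.* + N) (ℤ.+<+ 0<r))) (ℤ.<⇒≤ M<[1+q]N)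
    lowerGap : + M ℤ.- + q ℤ.* + N ≡ + r
    lowerGap = trans (cong (λ y → y ℤ.- + q ℤ.* + N) M≡r+qN) (ring (+ r) (+ q ℤ.* + N))
      where
      ring : ∀ a b → a ℤ.+ b ℤ.- b ≡ a
      ring = solve-∀
    upperGap : + suc q ℤ.* + N ℤ.- + M ≡ + (N ℕ.∸ r)
    upperGap = begin
      + suc q ℤ.* + N ℤ.- + M                     ≡⟨ cong (λ y → + suc q ℤ.* + N ℤ.- y) M≡r+qN ⟩
      + suc q ℤ.* + N ℤ.- (+ r ℤ.+ + q ℤ.* + N)   ≡⟨ ring (+ q) (+ r) (+ N) ⟩
      + N ℤ.- + r                                 ≡⟨ ℤ.m-n≡m⊖n N r ⟩
      N ℤ.⊖ r                                     ≡⟨ ℤ.⊖-≥ (ℕ.<⇒≤ (ℕ.m%n<n M N)) ⟩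
      + (N ℕ.∸ r)                                 ∎
      where
      ring : ∀ q r N → (1ℤ ℤ.+ q) ℤ.* N ℤ.- (r ℤ.+ q ℤ.* N) ≡ N ℤ.- r
      ring = solve-∀

  1/n≤t/np : ∀ n p .{{_ : NonZero n}} .{{_ : NonZero p}} .{{_ : NonZero (n ℕ.* p)}} {t} → p ℕ.≤ t → + 1 / n ≤ + t / (n ℕ.* p)
  1/n≤t/np n@(suc _) p@(suc _) {t} p≤t =
    ℚ.toℚᵘ-cancel-≤ (ℚᵘ.≤-respˡ-≃ (ℚᵘ.≃-sym (toℚᵘ-/ (+ 1) n)) (ℚᵘ.≤-respʳ-≃ (ℚᵘ.≃-sym (toℚᵘ-/ (+ t) (n ℕ.* p))) (*≤* (begin
      + 1 ℤ.* + (n ℕ.* p)   ≡⟨ ℤ.*-identityˡ (+ (n ℕ.* p)) ⟩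
      + (n ℕ.* p)           ≤⟨ ℤ.+≤+ (subst (n ℕ.* p ℕ.≤_) (ℕ.*-comm n t) (ℕ.*-monoʳ-≤ n p≤t)) ⟩
      + (t ℕ.* n)           ≡⟨ ℤ.pos-* t n ⟩
      + t ℤ.* + n           ∎))))
    where open ℤ.≤-Reasoning

  1/n≤‖M/np‖ : ∀ n p .{{_ : NonZero n}} .{{_ : NonZero p}} .{{_ : NonZero (n ℕ.* p)}} {M} →
               FarFromMultiples (n ℕ.* p) p M → + 1 / n ≤ ‖ + M / (n ℕ.* p) ‖
  1/n≤‖M/np‖ n p {M} (p≤r , r+p≤np) =
    subst (+ 1 / n ≤_) (sym (‖/‖ M (n ℕ.* p) (ℕ.<-≤-trans (ℕ.>-nonZero⁻¹ p) p≤r)))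
          (ℚ.⊓-glb (1/n≤t/np n p p≤r) (1/n≤t/np n p (ℕ.m+n≤o⇒m≤o∸n p (subst (ℕ._≤ n ℕ.* p) (ℕ.+-comm _ p) r+p≤np))))

open import Defs
open import Data.Nat using (ℕ; suc; _+_; _*_; _<_; _%_; NonZero)
open import Data.Nat.Primality using (Prime)
open import Data.Fin using (Fin; toℕ)
open import Data.Integer using (+_)
open import Data.Rational using (ℚ; _≤_; _/_) renaming (_*_ to _*ℚ_)
open import Data.Product using (Σ; ∃; _×_; _,_)
open import Relation.Binary.PropositionalEquality using (_≡_; _≢_; subst; sym)
open NumberTheory using (FarFromMultiples; module Dilation)
open Fractions using (*-/1; 1/n≤‖M/np‖)

proposition4 : (k p : ℕ) → .{{_ : NonZero p}} →
    Prime (suc k) → suc k ≢ 2 → Prime p → p ≢ 2 → k * k + k < p →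
    (u : Fin k → ℕ) → (∀ i → 0 < u i) →
    gcdFin k u ≡ 1 →
    (∀ i → u i % p ≡ suc (toℕ i) % p) →
    Σ ℚ (λ t → ∀ i → (+ 1 / suc k) ≤ ‖ t *ℚ (+ (u i) / 1) ‖)
proposition4 k p@(suc _) k+1-prime _ _ _ k*k+k<p u _ gcd≡1 u≡i =
  scale (Dilation.dilation k p k+1-prime k*k+k<p u u≡i gcd≡1)
  where
  scale : (∃ λ m → ∀ i → FarFromMultiples (suc k * p) p (m * u i)) → Σ ℚ (λ t → ∀ i → (+ 1 / suc k) ≤ ‖ t *ℚ (+ (u i) / 1) ‖)
  scale (m , far) = + m / (suc k * p) , λ i →
    subst (λ x → + 1 / suc k ≤ ‖ x ‖) (sym (*-/1 m (u i) (suc k * p))) (1/n≤‖M/np‖ (suc k) p {m * u i} (far i))
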